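{- For each integer $n\ge 6$, the distributive lattice $B_{3,n}$ is not nice; i.e. there exist partitions $\mu\unlhd\lambda$ of $2n+6$ such that $B_{3,n}$ has a chain partition of type $\lambda$ but no chain partition of type $\mu$.
   Context: For $n\ge 1$, $B_{3,n}$ is the poset on the $2n+6$ elements $\{a,b,c,d,e,f,1',1,2',2,\ldots,n',n\}$ whose order relation is the reflexive–transitive closure of the cover relations: $(i+1)\lessdot i$ and $(i+1)'\lessdot i'$ for $1\le i\le n-1$; $i'\lessdot i$ for $1\le i\le n$; $1'\lessdot e$, $1'\lessdot f$; $1\lessdot b$, $1\lessdot c$; $e\lessdot b$, $e\lessdot d$; $f\lessdot c$, $f\lessdot d$; $b\lessdot a$, $c\lessdot a$, $d\lessdot a$. A chain partition of a finite poset $P$ is a partition of the set $P$ into blocks each of which is a chain; its type is the integer partition formed by the block sizes in weakly decreasing order. For partitions $\mu,\nu$ of the same integer, $\mu\unlhd\nu$ (dominance order) means $\sum_{i\le k}\mu_i\le\sum_{i\le k}\nu_i$ for all $k\ge1$. A poset $P$ is nice if whenever $P$ has a chain partition of type $\lambda$, it also has a chain partition of type $\mu$ for every $\mu\unlhd\lambda$ (equivalently, the incomparability graph of $P$ is nice in the sense of stable partitions). -}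

module Defs where

open import Data.Nat using (ℕ; zero; suc; _+_; _*_; _≤_; _≥_)
open import Data.Fin using (Fin; toℕ)
open import Data.List using (List; []; _∷_; map; length; take; concat)
open import Data.Nat.ListAction using (sum)
open import Data.Empty using (⊥)
open import Data.Unit using (⊤)
open import Data.List.Membership.Propositional using (_∈_)
open import Data.List.Relation.Unary.All using (All)
open import Data.List.Relation.Unary.Unique.Propositional using (Unique)
open import Data.List.Relation.Unary.Linked using (Linked)
open import Data.List.Relation.Binary.Permutation.Propositional using (_↭_)
open import Relation.Binary.Construct.Closure.ReflexiveTransitive using (Star)
open import Relation.Binary.PropositionalEquality using (_≡_)
open import Data.Product using (Σ; _×_)
open import Data.Sum using (_⊎_)

-- Elements of B_{3,n}.  prm i is the element (toℕ i + 1)', unp i is (toℕ i + 1).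
data Elem (n : ℕ) : Set where
  a b c d e f : Elem n
  prm unp : Fin n → Elem n

data _⋖_ {n : ℕ} : Elem n → Elem n → Set where
  unp-cov  : (i j : Fin n) → toℕ j ≡ suc (toℕ i) → unp j ⋖ unp i
  prm-cov  : (i j : Fin n) → toℕ j ≡ suc (toℕ i) → prm j ⋖ prm i
  prm-unp  : (i : Fin n) → prm i ⋖ unp i
  one'-e   : (i : Fin n) → toℕ i ≡ 0 → prm i ⋖ e
  one'-f   : (i : Fin n) → toℕ i ≡ 0 → prm i ⋖ f
  one-b    : (i : Fin n) → toℕ i ≡ 0 → unp i ⋖ b
  one-c    : (i : Fin n) → toℕ i ≡ 0 → unp i ⋖ c
  e-b      : e ⋖ b
  e-d      : e ⋖ d
  f-c      : f ⋖ c
  f-d      : f ⋖ d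
  b-a      : b ⋖ a
  c-a      : c ⋖ a
  d-a      : d ⋖ a

_≼_ : {n : ℕ} → Elem n → Elem n → Set
_≼_ = Star _⋖_

Comparable : {n : ℕ} → Elem n → Elem n → Set
Comparable x y = x ≼ y ⊎ y ≼ x

IsChain : {n : ℕ} → List (Elem n) → Set
IsChain {n} B = (x y : Elem n) → x ∈ B → y ∈ B → Comparable x y

NonEmpty : {A : Set} → List A → Set
NonEmpty [] = ⊥
NonEmpty (_ ∷ _) = ⊤

IsChainPartition : {n : ℕ} → List (List (Elem n)) → Set
IsChainPartition {n} blocks =
  All NonEmpty blocks × All IsChain blocks ×
  ((x : Elem n) → x ∈ concat blocks) × Unique (concat blocks)

IsIntPartition : ℕ → List ℕ → Set
IsIntPartition m lam = Linked _≥_ lam × All (λ k → k ≥ 1) lam × sum lam ≡ m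

_⊴_ : List ℕ → List ℕ → Set
mu ⊴ lam = (k : ℕ) → sum (take k mu) ≤ sum (take k lam)

HasChainPartitionOfType : (n : ℕ) → List ℕ → Set
HasChainPartitionOfType n lam =
  Σ (List (List (Elem n))) λ blocks → IsChainPartition blocks × (map length blocks ↭ lam)

module Submission where

-- Type (n+1, n, 5) is realised by the chains  b > 1 > … > n,  a > d > e > 4' > … > n'
-- and  c > f > 1' > 2' > 3'.  Type (n, n, 6) is not: in a partition into three chains,
-- e, f and each i lie in three different chains, so the chain containing the whole
-- ladder 1 > … > n also contains one of b, c, d (b if d is with e, c if d is with f,
-- else d itself), hence has n + 1 elements.

open import Defs
open import Data.Bool using (Bool; true; false; f≤t; b≤b) renaming (_≤_ to _≤ᵇ_)
import Data.Bool.Properties as Bool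
open import Data.Nat using (ℕ; suc; _+_; _*_; _≤_; _<_; z≤n; s≤s)
open import Data.Nat.Properties using (≤-refl; ≤-reflexive; ≤-trans; n≤1+n; m≤m+n; <⇒≱)
open import Data.Nat.Tactic.RingSolver using (solve-∀)
open import Data.Fin using (Fin; suc; toℕ; punchOut; inject₁; inject≤; _↑ʳ_; _≟_)
open import Data.Fin.Patterns using (0F; 1F; 2F; 3F)
open import Data.Fin.Properties using (toℕ-inject₁; punchOut-injective; inject≤-injective; injective⇒≤)
open import Data.List using (List; []; _∷_; map; length; lookup; tabulate)
open import Data.List.Properties using (length-map; length-tabulate)
open import Data.List.Membership.Propositional using (_∈_)
open import Data.List.Membership.Propositional.Properties
  using (∈-map⁺; ∈-lookup; ∈-tabulate⁺; ∈-concat⁺′; ∈-concat⁻)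
open import Data.List.Relation.Unary.Any using (here; there; index)
open import Data.List.Relation.Unary.Any.Properties using (lookup-index)
open import Data.List.Relation.Unary.All as All using (All; []; _∷_)
import Data.List.Relation.Unary.All.Properties as All
open import Data.List.Relation.Unary.AllPairs using (AllPairs; []; _∷_)
import Data.List.Relation.Unary.AllPairs.Properties as AllPairs
open import Data.List.Relation.Unary.Linked using (Linked; [-]; _∷_)
open import Data.List.Relation.Unary.Linked.Properties using (Linked⇒AllPairs)
open import Data.List.Relation.Unary.Unique.Propositional using (Unique)
import Data.List.Relation.Unary.Unique.Propositional.Properties as Unique
open import Data.List.Relation.Binary.Disjoint.Propositional using (Disjoint)
open import Data.List.Relation.Binary.Permutation.Propositional using (↭-reflexive)
open import Data.List.Relation.Binary.Permutation.Propositional.Properties using (∈-resp-↭; ↭-length)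
open import Data.Empty using (⊥-elim)
open import Data.Unit using (tt)
open import Data.Sum using (inj₁; inj₂)
open import Data.Product using (Σ; _×_; ∃-syntax; _,_)
open import Function using (_∘_; Injective)
open import Relation.Binary.Construct.Closure.ReflexiveTransitive using (ε; _◅_; _◅◅_)
open import Relation.Binary.PropositionalEquality using (_≡_; _≢_; refl; sym; trans; cong; cong₂; subst; module ≡-Reasoning)
open import Relation.Nullary using (¬_; yes; no)

injective⇒≤-length : {A : Set} {m : ℕ} {xs : List A} (g : Fin m → A) →
                     Injective _≡_ _≡_ g → (∀ i → g i ∈ xs) → m ≤ length xs
injective⇒≤-length {xs = xs} g g-injective g∈xs = injective⇒≤ position-injective
  where
  open ≡-Reasoning
  position : Fin _ → Fin (length xs)
  position i = index (g∈xs i)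
  position-injective : Injective _≡_ _≡_ position
  position-injective {i} {j} eq = g-injective (begin
    g i                     ≡⟨ lookup-index (g∈xs i) ⟩
    lookup xs (position i)  ≡⟨ cong (lookup xs) eq ⟩
    lookup xs (position j)  ≡⟨ lookup-index (g∈xs j) ⟨
    g j                     ∎)

-- Removing p and then the image of q leaves Fin 1, where r and s must meet.
fin3-third : {p q r s : Fin 3} → p ≢ q → r ≢ p → r ≢ q → s ≢ p → s ≢ q → r ≡ s
fin3-third {p} {q} {r} {s} p≢q r≢p r≢q s≢p s≢q =
  punchOut-injective p≢r p≢s (punchOut-injective q′≢r′ q′≢s′ (fin1-unique _ _))
  where
  p≢r : p ≢ r
  p≢r = r≢p ∘ sym
  p≢s : p ≢ s
  p≢s = s≢p ∘ sym
  q′≢r′ : punchOut p≢q ≢ punchOut p≢r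
  q′≢r′ = r≢q ∘ sym ∘ punchOut-injective p≢q p≢r
  q′≢s′ : punchOut p≢q ≢ punchOut p≢s
  q′≢s′ = s≢q ∘ sym ∘ punchOut-injective p≢q p≢s
  fin1-unique : (x y : Fin 1) → x ≡ y
  fin1-unique 0F 0F = refl

third-unique : {m : ℕ} → m ≤ 3 → {p q r s : Fin m} →
               p ≢ q → r ≢ p → r ≢ q → s ≢ p → s ≢ q → r ≡ s
third-unique m≤3 p≢q r≢p r≢q s≢p s≢q =
  inject (fin3-third (p≢q ∘ inject) (r≢p ∘ inject) (r≢q ∘ inject) (s≢p ∘ inject) (s≢q ∘ inject))
  where
  inject : ∀ {i j} → inject≤ i m≤3 ≡ inject≤ j m≤3 → i ≡ j
  inject = inject≤-injective m≤3 m≤3 _ _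

linked-tabulate⁺ : {A : Set} {R : A → A → Set} {m : ℕ} {g : Fin (suc m) → A} →
                   (∀ i → R (g (inject₁ i)) (g (suc i))) → Linked R (tabulate g)
linked-tabulate⁺ {m = 0}     step = [-]
linked-tabulate⁺ {m = suc m} {g} step = step 0F ∷ linked-tabulate⁺ {g = g ∘ suc} (step ∘ suc)

toℕ-suc-inject₁ : {m : ℕ} (i : Fin m) → toℕ (suc i) ≡ suc (toℕ (inject₁ i))
toℕ-suc-inject₁ i = cong suc (sym (toℕ-inject₁ i))

module _ {n : ℕ} where

  _∥_ : Elem n → Elem n → Set
  x ∥ y = ¬ Comparable x y

  -- The monotone map onto the Boolean lattice 2³ that collapses the ladder of i, i'
  -- to the two bottom corners: i ↦ 100, e ↦ 010, f ↦ 001, i' ↦ 000, and joins above.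
  shape : Elem n → Bool × Bool × Bool
  shape a       = true  , true  , true
  shape b       = true  , true  , false
  shape c       = true  , false , true
  shape d       = false , true  , true
  shape e       = false , true  , false
  shape f       = false , false , true
  shape (unp _) = true  , false , false
  shape (prm _) = false , false , false

  _⊑_ : Bool × Bool × Bool → Bool × Bool × Bool → Set
  (x₁ , x₂ , x₃) ⊑ (y₁ , y₂ , y₃) = x₁ ≤ᵇ y₁ × x₂ ≤ᵇ y₂ × x₃ ≤ᵇ y₃

  ⊑-trans : ∀ {u v w} → u ⊑ v → v ⊑ w → u ⊑ w
  ⊑-trans (p₁ , p₂ , p₃) (q₁ , q₂ , q₃) = Bool.≤-trans p₁ q₁ , Bool.≤-trans p₂ q₂ , Bool.≤-trans p₃ q₃

  shape-⋖ : ∀ {x y} → x ⋖ y → shape x ⊑ shape y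
  shape-⋖ (unp-cov _ _ _) = b≤b , b≤b , b≤b
  shape-⋖ (prm-cov _ _ _) = b≤b , b≤b , b≤b
  shape-⋖ (prm-unp _)     = f≤t , b≤b , b≤b
  shape-⋖ (one'-e _ _)    = b≤b , f≤t , b≤b
  shape-⋖ (one'-f _ _)    = b≤b , b≤b , f≤t
  shape-⋖ (one-b _ _)     = b≤b , f≤t , b≤b
  shape-⋖ (one-c _ _)     = b≤b , b≤b , f≤t
  shape-⋖ e-b             = f≤t , b≤b , b≤b
  shape-⋖ e-d             = b≤b , b≤b , f≤t
  shape-⋖ f-c             = f≤t , b≤b , b≤b
  shape-⋖ f-d             = b≤b , f≤t , b≤b
  shape-⋖ b-a             = b≤b , b≤b , f≤t
  shape-⋖ c-a             = b≤b , f≤t , b≤b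
  shape-⋖ d-a             = f≤t , b≤b , b≤b

  shape-≼ : ∀ {x y} → x ≼ y → shape x ⊑ shape y
  shape-≼ ε           = b≤b , b≤b , b≤b
  shape-≼ (x⋖y ◅ y≼z) = ⊑-trans (shape-⋖ x⋖y) (shape-≼ y≼z)

  ∥-by-shape : ∀ {x y} → ¬ shape x ⊑ shape y → ¬ shape y ⊑ shape x → x ∥ y
  ∥-by-shape x⋢y _ (inj₁ x≼y) = x⋢y (shape-≼ x≼y)
  ∥-by-shape _ y⋢x (inj₂ y≼x) = y⋢x (shape-≼ y≼x)

  e∥f : e ∥ f
  e∥f = ∥-by-shape (λ { (_ , () , _) }) (λ { (_ , _ , ()) })

  i∥e : ∀ {i} → unp i ∥ e
  i∥e = ∥-by-shape (λ { (() , _ , _) }) (λ { (_ , () , _) })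

  i∥f : ∀ {i} → unp i ∥ f
  i∥f = ∥-by-shape (λ { (() , _ , _) }) (λ { (_ , _ , ()) })

  b∥d : b ∥ d
  b∥d = ∥-by-shape (λ { (() , _ , _) }) (λ { (_ , _ , ()) })

  b∥f : b ∥ f
  b∥f = ∥-by-shape (λ { (() , _ , _) }) (λ { (_ , _ , ()) })

  c∥d : c ∥ d
  c∥d = ∥-by-shape (λ { (() , _ , _) }) (λ { (_ , () , _) })

  c∥e : c ∥ e
  c∥e = ∥-by-shape (λ { (() , _ , _) }) (λ { (_ , () , _) })

  _≽_ : Elem n → Elem n → Set
  x ≽ y = y ≼ x

  pairwise⇒chain : ∀ {B} → AllPairs _≽_ B → IsChain B
  pairwise⇒chain (_ ∷ _)   x y (here refl) (here refl) = inj₁ ε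
  pairwise⇒chain (x≽ ∷ _)  x y (here refl) (there y∈) = inj₂ (All.lookup x≽ y∈)
  pairwise⇒chain (y≽ ∷ _)  x y (there x∈) (here refl) = inj₁ (All.lookup y≽ x∈)
  pairwise⇒chain (_ ∷ ps)  x y (there x∈) (there y∈) = pairwise⇒chain ps x y x∈ y∈

  descending⇒chain : ∀ {B} → Linked _≽_ B → IsChain B
  descending⇒chain = pairwise⇒chain ∘ Linked⇒AllPairs (λ y≼x z≼y → z≼y ◅◅ y≼x)

  labelled⇒chainPartition : {m : ℕ} (B : Fin m → List (Elem n)) (label : Elem n → Fin m) →
    (∀ k → NonEmpty (B k)) → (∀ k → IsChain (B k)) → (∀ k → Unique (B k)) →
    (∀ k → All (λ x → label x ≡ k) (B k)) → (∀ x → x ∈ B (label x)) →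
    IsChainPartition (tabulate B)
  labelled⇒chainPartition B label nonEmpty chain unique labelled ∈-labelled =
    All.tabulate⁺ nonEmpty , All.tabulate⁺ chain ,
    (λ x → ∈-concat⁺′ (∈-labelled x) (∈-tabulate⁺ (label x))) ,
    Unique.concat⁺ (All.tabulate⁺ unique) (AllPairs.tabulate⁺ disjoint)
    where
    disjoint : ∀ {k l} → k ≢ l → Disjoint (B k) (B l)
    disjoint k≢l (x∈k , x∈l) =
      k≢l (trans (sym (All.lookup (labelled _) x∈k)) (All.lookup (labelled _) x∈l))

  module _ {m : ℕ} (m≤3 : m ≤ 3) (B : Fin m → List (Elem n)) (chain : ∀ k → IsChain (B k))
           (block : Elem n → Fin m) (∈-block : ∀ x → x ∈ B (block x)) where

    apart : ∀ {x y} → x ∥ y → block x ≢ block y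
    apart x∥y eq = x∥y (chain _ _ _ (subst (λ k → _ ∈ B k) eq (∈-block _)) (∈-block _))

    long-beside : ∀ t → (∀ i → t ≢ unp i) → block t ≢ block e → block t ≢ block f →
                  n < length (B (block t))
    long-beside t t≢unp t≁e t≁f = injective⇒≤-length t-and-ladder injective ∈-B
      where
      t-and-ladder : Fin (suc n) → Elem n
      t-and-ladder 0F      = t
      t-and-ladder (suc i) = unp i
      injective : Injective _≡_ _≡_ t-and-ladder
      injective {0F}    {0F}    _    = refl
      injective {0F}    {suc j} eq   = ⊥-elim (t≢unp j eq)
      injective {suc i} {0F}    eq   = ⊥-elim (t≢unp i (sym eq))
      injective {suc i} {suc j} refl = refl
      ∈-B : ∀ j → t-and-ladder j ∈ B (block t)
      ∈-B 0F      = ∈-block t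
      ∈-B (suc i) = subst (λ k → unp i ∈ B k)
        (third-unique m≤3 (apart e∥f) (apart i∥e) (apart i∥f) t≁e t≁f) (∈-block (unp i))

    long-block : ∃[ k ] n < length (B k)
    long-block with block d ≟ block e | block d ≟ block f
    ... | yes d~e | _       = block b , long-beside b (λ _ ())
                                (λ b~e → apart b∥d (trans b~e (sym d~e))) (apart b∥f)
    ... | no _    | yes d~f = block c , long-beside c (λ _ ())
                                (apart c∥e) (λ c~f → apart c∥d (trans c~f (sym d~f)))
    ... | no d≁e  | no d≁f  = block d , long-beside d (λ _ ()) d≁e d≁f

  long-chain : (bs : List (List (Elem n))) → IsChainPartition bs → length bs ≤ 3 →
               ∃[ k ] n < length (lookup bs k)
  long-chain bs (_ , chains , covered , _) bs≤3 =
    long-block bs≤3 (lookup bs) (λ k → All.lookup chains (∈-lookup k)) block ∈-block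
    where
    block : Elem n → Fin (length bs)
    block x = index (∈-concat⁻ bs (covered x))
    ∈-block : ∀ x → x ∈ lookup bs (block x)
    ∈-block x = lookup-index (∈-concat⁻ bs (covered x))

lam mu : ℕ → List ℕ
lam n = suc n ∷ n ∷ 5 ∷ []
mu  n = n ∷ n ∷ 6 ∷ []

module Witness (k : ℕ) where

  n : ℕ
  n = 4 + k

  lower-primes : Fin (suc k) → Elem n
  lower-primes i = prm (3 ↑ʳ i)

  block : Fin 3 → List (Elem n)
  block 0F = b ∷ tabulate unp
  block 1F = a ∷ d ∷ e ∷ tabulate lower-primes
  block 2F = c ∷ f ∷ prm 0F ∷ prm 1F ∷ prm 2F ∷ []

  label : Elem n → Fin 3
  label b                         = 0F
  label (unp _)                   = 0F
  label a                         = 1F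
  label d                         = 1F
  label e                         = 1F
  label (prm (suc (suc (suc _)))) = 1F
  label c                         = 2F
  label f                         = 2F
  label (prm 0F)                  = 2F
  label (prm 1F)                  = 2F
  label (prm 2F)                  = 2F

  descending : ∀ l → Linked _≽_ (block l)
  descending 0F = (one-b 0F refl ◅ ε)
    ∷ linked-tabulate⁺ {g = unp} (λ i → unp-cov _ _ (toℕ-suc-inject₁ i) ◅ ε)
  descending 1F = (d-a ◅ ε) ∷ (e-d ◅ ε)
    ∷ (prm-cov 2F 3F refl ◅ prm-cov 1F 2F refl ◅ prm-cov 0F 1F refl ◅ one'-e 0F refl ◅ ε)
    ∷ linked-tabulate⁺ {g = lower-primes} (λ i → prm-cov _ _ (cong (3 +_) (toℕ-suc-inject₁ i)) ◅ ε)
  descending 2F = (f-c ◅ ε) ∷ (one'-f 0F refl ◅ ε)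
    ∷ (prm-cov 0F 1F refl ◅ ε) ∷ (prm-cov 1F 2F refl ◅ ε) ∷ [-]

  unique : ∀ l → Unique (block l)
  unique 0F = All.tabulate⁺ {f = unp} (λ _ ()) ∷ Unique.tabulate⁺ {f = unp} λ { refl → refl }
  unique 1F = ((λ ()) ∷ (λ ()) ∷ All.tabulate⁺ {f = lower-primes} (λ _ ()))
            ∷ ((λ ()) ∷ All.tabulate⁺ {f = lower-primes} (λ _ ()))
            ∷ All.tabulate⁺ {f = lower-primes} (λ _ ())
            ∷ Unique.tabulate⁺ {f = lower-primes} λ { refl → refl }
  unique 2F = ((λ ()) ∷ (λ ()) ∷ (λ ()) ∷ (λ ()) ∷ [])
            ∷ ((λ ()) ∷ (λ ()) ∷ (λ ()) ∷ [])
            ∷ ((λ ()) ∷ (λ ()) ∷ [])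
            ∷ ((λ ()) ∷ [])
            ∷ [] ∷ []

  labelled : ∀ l → All (λ x → label x ≡ l) (block l)
  labelled 0F = refl ∷ All.tabulate⁺ {f = unp} (λ _ → refl)
  labelled 1F = refl ∷ refl ∷ refl ∷ All.tabulate⁺ {f = lower-primes} (λ _ → refl)
  labelled 2F = refl ∷ refl ∷ refl ∷ refl ∷ refl ∷ []

  ∈-labelled : ∀ x → x ∈ block (label x)
  ∈-labelled a                         = here refl
  ∈-labelled b                         = here refl
  ∈-labelled c                         = here refl
  ∈-labelled d                         = there (here refl)
  ∈-labelled e                         = there (there (here refl))
  ∈-labelled f                         = there (here refl)
  ∈-labelled (unp i)                   = there (∈-tabulate⁺ {f = unp} i)
  ∈-labelled (prm 0F)                  = there (there (here refl))
  ∈-labelled (prm 1F)                  = there (there (there (here refl)))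
  ∈-labelled (prm 2F)                  = there (there (there (there (here refl))))
  ∈-labelled (prm (suc (suc (suc i)))) = there (there (there (∈-tabulate⁺ {f = lower-primes} i)))

  block-lengths : map length (tabulate block) ≡ lam n
  block-lengths = cong₂ (λ z x → suc z ∷ 3 + x ∷ 5 ∷ []) (length-tabulate unp) (length-tabulate lower-primes)

  chainPartition-lam : HasChainPartitionOfType n (lam n)
  chainPartition-lam =
    tabulate block ,
    labelled⇒chainPartition block label (λ { 0F → tt ; 1F → tt ; 2F → tt })
      (descending⇒chain ∘ descending) unique labelled ∈-labelled ,
    ↭-reflexive block-lengths

chainPartition-lam : ∀ {n} → 4 ≤ n → HasChainPartitionOfType n (lam n)
chainPartition-lam (s≤s (s≤s (s≤s (s≤s (z≤n {k}))))) = Witness.chainPartition-lam k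

no-chainPartition-mu : ∀ {n} → 6 ≤ n → ¬ HasChainPartitionOfType n (mu n)
no-chainPartition-mu {n} 6≤n (bs , partition , lengths) =
  let (k , n<|Bₖ|) = long-chain bs partition (≤-reflexive three-blocks)
  in <⇒≱ n<|Bₖ| (All.lookup parts≤n (∈-resp-↭ lengths (∈-map⁺ length (∈-lookup k))))
  where
  three-blocks : length bs ≡ 3
  three-blocks = trans (sym (length-map length bs)) (↭-length lengths)
  parts≤n : All (_≤ n) (mu n)
  parts≤n = ≤-refl ∷ ≤-refl ∷ 6≤n ∷ []

lam-partition : ∀ {n} → 5 ≤ n → IsIntPartition (2 * n + 6) (lam n)
lam-partition {n} 5≤n =
  (n≤1+n n ∷ 5≤n ∷ [-]) , (s≤s z≤n ∷ ≤-trans (s≤s z≤n) 5≤n ∷ s≤s z≤n ∷ []) , sum-lam n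
  where
  sum-lam : ∀ n → suc n + (n + (5 + 0)) ≡ 2 * n + 6
  sum-lam = solve-∀

mu-partition : ∀ {n} → 6 ≤ n → IsIntPartition (2 * n + 6) (mu n)
mu-partition {n} 6≤n =
  (≤-refl ∷ 6≤n ∷ [-]) , (1≤n ∷ 1≤n ∷ s≤s z≤n ∷ []) , sum-mu n
  where
  1≤n : 1 ≤ n
  1≤n = ≤-trans (s≤s z≤n) 6≤n
  sum-mu : ∀ n → n + (n + (6 + 0)) ≡ 2 * n + 6
  sum-mu = solve-∀

mu⊴lam : ∀ n → mu n ⊴ lam n
mu⊴lam n 0                   = z≤n
mu⊴lam n 1                   = n≤1+n _
mu⊴lam n 2                   = n≤1+n _
mu⊴lam n (suc (suc (suc _))) = ≤-reflexive (same-total n _)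
  where
  same-total : ∀ n s → n + (n + (6 + s)) ≡ suc n + (n + (5 + s))
  same-total = solve-∀

theorem3p2 : (n : ℕ) → 6 ≤ n →
    Σ (List ℕ) λ lam → Σ (List ℕ) λ mu →
      IsIntPartition (2 * n + 6) lam × IsIntPartition (2 * n + 6) mu × mu ⊴ lam ×
      HasChainPartitionOfType n lam × ¬ HasChainPartitionOfType n mu
theorem3p2 n 6≤n =
  lam n , mu n ,
  lam-partition (≤-trans (n≤1+n 5) 6≤n) , mu-partition 6≤n , mu⊴lam n ,
  chainPartition-lam (≤-trans (m≤m+n 4 2) 6≤n) , no-chainPartition-mu 6≤n
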